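{- Let $\rhd$ be a system of ideals for an ordered group $G$. If $G$ is $\rhd$-closed, then $G$ embeds into the Lorenzen group associated with $\rhd$, i.e. the natural morphism $G\to H$ into the Lorenzen group $H$ is injective and order-reflecting.
   Context: Monoids and groups are commutative. An ordered group is a commutative group $G$ with a partial order $\le_G$ compatible with addition. $\mathrm{P}_{\mathrm{fe}}^*(G)$ is the set of nonempty finite subsets of $G$; $a$ stands for $\{a\}$, $A,A'$ for $A\cup A'$, $x+A=\{x+a\}$, $A-B=\{a-b\}$. A system of ideals for $G$ is a relation $\rhd$ between $\mathrm{P}_{\mathrm{fe}}^*(G)$ and $G$ such that: $a\rhd a$; $A\rhd b\Rightarrow A,A'\rhd b$; ($A\rhd c$ and $A,c\rhd b$) $\Rightarrow A\rhd b$; $a\le_G b\Rightarrow a\rhd b$; $A\rhd b\Rightarrow x+A\rhd x+b$. $\rhd_2$ is coarser than $\rhd_1$ if $A\rhd_1 b$ implies $A\rhd_2 b$. For $y_1,\dots,y_n\in G$, $\rhd_{y_1,\dots,y_n}$ is the finest system of ideals coarser than $\rhd$ with $0\rhd_{y_1,\dots,y_n}y_i$ for all $i$. The regularisation of $\rhd$ is the relation on $\mathrm{P}_{\mathrm{fe}}^*(G)$: $A\vdash_{\rhd}B$ iff there exist $x_1,\dots,x_m\in G$ with $A-B\rhd_{\pm x_1,\dots,\pm x_m}0$ for every choice of signs. $G$ is $\rhd$-closed if $a\vdash_\rhd b$ implies $a\le_G b$ for all $a,b\in G$. The regularisation is an unbounded entailment relation; the distributive lattice $H$ it generates (presented by generators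 the elements of $G$ and relations $\bigwedge A\le\bigvee B$ whenever $A\vdash_\rhd B$, no top or bottom required) carries a unique group law compatible with the lattice operations (addition distributes over $\wedge$ and $\vee$) for which the natural map $G\to H$ is a group morphism; this lattice-ordered group $H$ is the Lorenzen group associated with $\rhd$. -}

module Defs where

open import Data.Product using (Σ; _×_; _,_)
open import Data.Sum using (_⊎_)
open import Data.Bool using (Bool; true; false)
open import Data.List using (List; []; _∷_)
open import Data.List.NonEmpty as L⁺ using (List⁺; [_]; _∷_; toList)
open import Data.List.Membership.Propositional using (_∈_)
open import Data.List.Relation.Binary.Pointwise using (Pointwise)
open import Relation.Binary.PropositionalEquality using (_≡_)

record OrderedGroup : Set₁ where
  infixl 6 _+_
  infix 4 _≤_
  field
    Carrier : Set
    _+_ : Carrier → Carrier → Carrier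
    0# : Carrier
    -_ : Carrier → Carrier
    +-assoc : ∀ x y z → (x + y) + z ≡ x + (y + z)
    +-comm : ∀ x y → x + y ≡ y + x
    +-identityˡ : ∀ x → 0# + x ≡ x
    -‿inverseˡ : ∀ x → (- x) + x ≡ 0#
    _≤_ : Carrier → Carrier → Set
    ≤-refl : ∀ x → x ≤ x
    ≤-trans : ∀ {x y z} → x ≤ y → y ≤ z → x ≤ z
    ≤-antisym : ∀ {x y} → x ≤ y → y ≤ x → x ≡ y
    ≤-compat : ∀ {x y} z → x ≤ y → x + z ≤ y + z

  _-_ : Carrier → Carrier → Carrier
  x - y = x + (- y)

module _ (G : OrderedGroup) where
  open OrderedGroup G

  -- Nonempty finite subsets of G, represented by nonempty lists;
  -- inclusion is inclusion of the underlying sets of elements.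
  Pfe : Set
  Pfe = List⁺ Carrier

  _⊆_ : Pfe → Pfe → Set
  A ⊆ A' = ∀ x → x ∈ toList A → x ∈ toList A'

  _+ₛ_ : Carrier → Pfe → Pfe
  x +ₛ A = L⁺.map (x +_) A

  _-ₛ_ : Pfe → Pfe → Pfe
  A -ₛ B = L⁺.concatMap (λ a → L⁺.map (λ b → a - b) B) A

  _,ₛ_ : Pfe → Carrier → Pfe
  A ,ₛ c = c ∷ toList A

  -- Monotonicity is stated for arbitrary inclusions
  -- A ⊆ A', which covers "A ▷ b ⇒ A,A' ▷ b" and makes ▷ a relation on
  -- finite *sets* (independent of list order / repetitions).
  record IsSystemOfIdeals (_▷_ : Pfe → Carrier → Set) : Set where
    field
      ▷-refl  : ∀ a → [ a ] ▷ a
      ▷-mono  : ∀ {A A' b} → A ⊆ A' → A ▷ b → A' ▷ b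
      ▷-cut   : ∀ {A b c} → A ▷ c → (A ,ₛ c) ▷ b → A ▷ b
      ▷-ord   : ∀ {a b} → a ≤ b → [ a ] ▷ b
      ▷-trans : ∀ {A b} x → A ▷ b → (x +ₛ A) ▷ (x + b)

  -- ▷_{y₁,…,yₙ}: the finest system of ideals coarser than ▷ with 0 ▷ yᵢ,
  -- defined as the inductive closure.
  data Ext (_▷_ : Pfe → Carrier → Set) (ys : List Carrier) : Pfe → Carrier → Set where
    base  : ∀ {A b} → A ▷ b → Ext _▷_ ys A b
    extra : ∀ {y} → y ∈ ys → Ext _▷_ ys [ 0# ] y
    e-refl  : ∀ a → Ext _▷_ ys [ a ] a
    e-mono  : ∀ {A A' b} → A ⊆ A' → Ext _▷_ ys A b → Ext _▷_ ys A' b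
    e-cut   : ∀ {A b c} → Ext _▷_ ys A c → Ext _▷_ ys (A ,ₛ c) b → Ext _▷_ ys A b
    e-ord   : ∀ {a b} → a ≤ b → Ext _▷_ ys [ a ] b
    e-trans : ∀ {A b} x → Ext _▷_ ys A b → Ext _▷_ ys (x +ₛ A) (x + b)

  SignChoice : List Carrier → List Carrier → Set
  SignChoice = Pointwise (λ x y → (y ≡ x) ⊎ (y ≡ - x))

  Reg : (Pfe → Carrier → Set) → Pfe → Pfe → Set
  Reg _▷_ A B = Σ (List Carrier) λ xs →
    ∀ ys → SignChoice xs ys → Ext _▷_ ys (A -ₛ B) 0#

  Closed : (Pfe → Carrier → Set) → Set
  Closed _▷_ = ∀ a b → Reg _▷_ [ a ] [ b ] → a ≤ b

  -- The (unbounded) distributive lattice generated by the regularisation: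
  -- formal lattice terms over G, with the preorder generated by the
  -- distributive-lattice laws and the relations ⋀A ≤ ⋁B for A ⊢ B.
  data Term : Set where
    gen : Carrier → Term
    _∧_ : Term → Term → Term
    _∨_ : Term → Term → Term

  ⋀ : Pfe → Term
  ⋀ A = L⁺.foldr₁ _∧_ (L⁺.map gen A)

  ⋁ : Pfe → Term
  ⋁ A = L⁺.foldr₁ _∨_ (L⁺.map gen A)

  module Lorenzen (R : Pfe → Carrier → Set) where
    infix 4 _≤H_ _≈H_
    data _≤H_ : Term → Term → Set where
      h-refl  : ∀ {x} → x ≤H x
      h-trans : ∀ {x y z} → x ≤H y → y ≤H z → x ≤H z
      ∧-lbˡ   : ∀ {x y} → (x ∧ y) ≤H x
      ∧-lbʳ   : ∀ {x y} → (x ∧ y) ≤H y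
      ∧-glb   : ∀ {x y z} → z ≤H x → z ≤H y → z ≤H (x ∧ y)
      ∨-ubˡ   : ∀ {x y} → x ≤H (x ∨ y)
      ∨-ubʳ   : ∀ {x y} → y ≤H (x ∨ y)
      ∨-lub   : ∀ {x y z} → x ≤H z → y ≤H z → (x ∨ y) ≤H z
      distrib : ∀ {x y z} → (x ∧ (y ∨ z)) ≤H ((x ∧ y) ∨ (x ∧ z))
      entail  : ∀ {A B} → Reg R A B → ⋀ A ≤H ⋁ B

    _≈H_ : Term → Term → Set
    x ≈H y = (x ≤H y) × (y ≤H x)

    ι : Carrier → Term
    ι = gen

-- The regularisation ⊢ of ▷ is an entailment relation: it is reflexive, monotone
-- and satisfies cut.  Cut is the heart of the matter: given witnesses for
-- A ⊢ c,B and c,A ⊢ B, one adds the elements b − c (b ∈ B) to the witness list;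
-- for every choice of signs either some 0 ▷ b − c, and c is cut from the left
-- entailment, or all 0 ▷ c − b, and then A ▷ c, so c is cut from the right one.
-- An entailment relation interprets the distributive lattice it generates:
-- if x ≤ y in H, then every conjunctive clause of a disjunctive normal form of x
-- entails every disjunctive clause of a conjunctive normal form of y.  For
-- generators this says that a ≤ b in H forces a ⊢ b, hence a ≤ b in a closed G.

module Submission where

open import Defs hiding (_⊆_; _+ₛ_; _-ₛ_; _,ₛ_)
import Defs as D
open import Data.Product using (_×_; ∃-syntax; ∃₂; _,_)
open import Data.Sum using (_⊎_; inj₁; inj₂; [_,_]′)
import Data.Sum as Sum
open import Data.List as List using ([]; _∷_; _++_; cartesianProductWith)
open import Data.List.NonEmpty as L⁺ using ([_]; _∷_; toList; _⁺++⁺_)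
open import Data.List.Membership.Propositional using (_∈_; find)
open import Data.List.Membership.Propositional.Properties
  using (∈-map⁻; ∈-++⁺ˡ; ∈-++⁺ʳ; ∈-++⁻; ∈-cartesianProductWith⁺; ∈-cartesianProductWith⁻)
open import Data.List.Relation.Unary.Any using (Any; here; there)
open import Data.List.Relation.Unary.All as All using (All; []; _∷_)
open import Data.List.Relation.Binary.Pointwise using (Pointwise; []; _∷_)
open import Function using (_∘_)
open import Level using (0ℓ)
open import Relation.Unary using (Pred; _∪_)
open import Relation.Binary.PropositionalEquality
  using (_≡_; refl; sym; trans; cong; subst; module ≡-Reasoning)

Pointwise-++⁻ˡ : ∀ {A B : Set} {_∼_ : A → B → Set} xs₁ {xs₂ ys} →
  Pointwise _∼_ (xs₁ ++ xs₂) ys →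
  ∃₂ λ ys₁ ys₂ → Pointwise _∼_ xs₁ ys₁ × Pointwise _∼_ xs₂ ys₂ × ys ≡ ys₁ ++ ys₂
Pointwise-++⁻ˡ []        rs       = [] , _ , [] , rs , refl
Pointwise-++⁻ˡ (x ∷ xs₁) (r ∷ rs) with Pointwise-++⁻ˡ xs₁ rs
... | ys₁ , ys₂ , rs₁ , rs₂ , refl = _ ∷ ys₁ , ys₂ , r ∷ rs₁ , rs₂ , refl

Pointwise-∈ : ∀ {A B : Set} {_∼_ : A → B → Set} {xs ys x} →
  Pointwise _∼_ xs ys → x ∈ xs → ∃[ y ] y ∈ ys × x ∼ y
Pointwise-∈ (r ∷ rs) (here refl) = _ , here refl , r
Pointwise-∈ (r ∷ rs) (there x∈) with Pointwise-∈ rs x∈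
... | y , y∈ , r′ = y , there y∈ , r′

All-⊎⇒Any⊎All : ∀ {A : Set} {P Q : Pred A 0ℓ} {xs} → All (P ∪ Q) xs → Any P xs ⊎ All Q xs
All-⊎⇒Any⊎All []               = inj₂ []
All-⊎⇒Any⊎All (inj₁ p ∷ pqs)   = inj₁ (here p)
All-⊎⇒Any⊎All (inj₂ q ∷ pqs)   = Sum.map there (q ∷_) (All-⊎⇒Any⊎All pqs)

module _ (G : OrderedGroup) where
  open OrderedGroup G

  +-identityʳ : ∀ x → x + 0# ≡ x
  +-identityʳ x = trans (+-comm x 0#) (+-identityˡ x)

  -‿inverseʳ : ∀ x → x - x ≡ 0#
  -‿inverseʳ x = trans (+-comm x (- x)) (-‿inverseˡ x)

  -x+[x+y]≡y : ∀ x y → - x + (x + y) ≡ y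
  -x+[x+y]≡y x y = begin
    - x + (x + y)   ≡⟨ sym (+-assoc (- x) x y) ⟩
    (- x + x) + y   ≡⟨ cong (_+ y) (-‿inverseˡ x) ⟩
    0# + y          ≡⟨ +-identityˡ y ⟩
    y               ∎
    where open ≡-Reasoning

  x+[y-x]≡y : ∀ x y → x + (y - x) ≡ y
  x+[y-x]≡y x y = begin
    x + (y - x)     ≡⟨ cong (x +_) (+-comm y (- x)) ⟩
    x + (- x + y)   ≡⟨ sym (+-assoc x (- x) y) ⟩
    (x - x) + y     ≡⟨ cong (_+ y) (-‿inverseʳ x) ⟩
    0# + y          ≡⟨ +-identityˡ y ⟩
    y               ∎
    where open ≡-Reasoning

  [x-y]+[y-z]≡x-z : ∀ x y z → (x - y) + (y - z) ≡ x - z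
  [x-y]+[y-z]≡x-z x y z = trans (+-assoc x (- y) (y - z)) (cong (x +_) (-x+[x+y]≡y y (- z)))

  -‿unique : ∀ {x y} → x + y ≡ 0# → y ≡ - x
  -‿unique {x} {y} x+y≡0 = begin
    y               ≡⟨ sym (-x+[x+y]≡y x y) ⟩
    - x + (x + y)   ≡⟨ cong (- x +_) x+y≡0 ⟩
    - x + 0#        ≡⟨ +-identityʳ (- x) ⟩
    - x             ∎
    where open ≡-Reasoning

  -[x-y]≡y-x : ∀ x y → - (x - y) ≡ y - x
  -[x-y]≡y-x x y = sym (-‿unique (trans ([x-y]+[y-z]≡x-z x y x) (-‿inverseʳ x)))

  infix  4 _⊆_
  infixr 6 _+ₛ_
  infix  7 _-ₛ_
  infixl 6 _,ₛ_

  _⊆_ : Pfe G → Pfe G → Set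
  _⊆_ = D._⊆_ G

  _+ₛ_ : Carrier → Pfe G → Pfe G
  _+ₛ_ = D._+ₛ_ G

  _-ₛ_ : Pfe G → Pfe G → Pfe G
  _-ₛ_ = D._-ₛ_ G

  _,ₛ_ : Pfe G → Carrier → Pfe G
  _,ₛ_ = D._,ₛ_ G

  ⊆-refl : ∀ {A} → A ⊆ A
  ⊆-refl _ x∈ = x∈

  ⊆-⁺++⁺ˡ : ∀ A B → A ⊆ A ⁺++⁺ B
  ⊆-⁺++⁺ˡ (_ ∷ _) (_ ∷ _) _ = ∈-++⁺ˡ

  ⊆-⁺++⁺ʳ : ∀ A B → B ⊆ A ⁺++⁺ B
  ⊆-⁺++⁺ʳ A@(_ ∷ _) (_ ∷ _) _ = ∈-++⁺ʳ (toList A)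

  ⁺++⁺-⊆ : ∀ {A B C} → A ⊆ C → B ⊆ C → A ⁺++⁺ B ⊆ C
  ⁺++⁺-⊆ {A@(_ ∷ _)} {_ ∷ _} A⊆C B⊆C x = [ A⊆C x , B⊆C x ]′ ∘ ∈-++⁻ (toList A)

  ⁺++⁺-exchange-⊆ : ∀ A B C → (A ⁺++⁺ B) ⁺++⁺ C ⊆ B ⁺++⁺ (A ⁺++⁺ C)
  ⁺++⁺-exchange-⊆ A B C =
    ⁺++⁺-⊆ (⁺++⁺-⊆ (λ x x∈ → ⊆-⁺++⁺ʳ B (A ⁺++⁺ C) x (⊆-⁺++⁺ˡ A C x x∈)) (⊆-⁺++⁺ˡ B (A ⁺++⁺ C)))
           (λ x x∈ → ⊆-⁺++⁺ʳ B (A ⁺++⁺ C) x (⊆-⁺++⁺ʳ A C x x∈))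

  ∈-translate⁻ : ∀ {x y} A → y ∈ toList (x +ₛ A) → ∃[ a ] a ∈ toList A × y ≡ x + a
  ∈-translate⁻ (_ ∷ _) = ∈-map⁻ _

  toList-diff : ∀ A B → toList (A -ₛ B) ≡ cartesianProductWith _-_ (toList A) (toList B)
  toList-diff (a ∷ as) B@(b ∷ bs) = cong (λ l → a - b ∷ List.map (_-_ a) bs ++ l) (rows as)
    where
    rows : ∀ as → List.concat (List.map toList (List.map (λ a → L⁺.map (λ b → a - b) B) as))
                ≡ cartesianProductWith _-_ as (toList B)
    rows []       = refl
    rows (a ∷ as) = cong (List.map (_-_ a) (toList B) ++_) (rows as)

  ∈-diff⁺ : ∀ {a b} A B → a ∈ toList A → b ∈ toList B → a - b ∈ toList (A -ₛ B)
  ∈-diff⁺ {a} {b} A B a∈ b∈ = subst (a - b ∈_) (sym (toList-diff A B)) (∈-cartesianProductWith⁺ _-_ a∈ b∈)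

  ∈-diff⁻ : ∀ {y} A B → y ∈ toList (A -ₛ B) →
    ∃₂ λ a b → a ∈ toList A × b ∈ toList B × y ≡ a - b
  ∈-diff⁻ {y} A B y∈ = ∈-cartesianProductWith⁻ _-_ (toList A) (toList B) (subst (y ∈_) (toList-diff A B) y∈)

  diff-mono : ∀ {A A′ B B′} → A ⊆ A′ → B ⊆ B′ → A -ₛ B ⊆ A′ -ₛ B′
  diff-mono {A} {A′} {B} {B′} A⊆A′ B⊆B′ y y∈ with ∈-diff⁻ A B y∈
  ... | a , b , a∈ , b∈ , refl = ∈-diff⁺ A′ B′ (A⊆A′ a a∈) (B⊆B′ b b∈)

  diff-,ₛˡ : ∀ A B c {y} → y ∈ toList ((A ,ₛ c) -ₛ B) →
    y ∈ toList ([ c ] -ₛ B) ⊎ y ∈ toList (A -ₛ B)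
  diff-,ₛˡ A B c y∈ with ∈-diff⁻ (A ,ₛ c) B y∈
  ... | _ , _ , here refl , b∈ , refl = inj₁ (∈-diff⁺ [ c ] B (here refl) b∈)
  ... | _ , _ , there a∈ , b∈ , refl = inj₂ (∈-diff⁺ A B a∈ b∈)

  diff-,ₛʳ : ∀ A B c {y} → y ∈ toList (A -ₛ (B ,ₛ c)) →
    y ∈ toList (A -ₛ [ c ]) ⊎ y ∈ toList (A -ₛ B)
  diff-,ₛʳ A B c y∈ with ∈-diff⁻ A (B ,ₛ c) y∈
  ... | _ , _ , a∈ , here refl , refl = inj₁ (∈-diff⁺ A [ c ] a∈ (here refl))
  ... | _ , _ , a∈ , there b∈ , refl = inj₂ (∈-diff⁺ A B a∈ b∈)

  translate-⊆-diff : ∀ {b} A B → b ∈ toList B → - b +ₛ A ⊆ A -ₛ B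
  translate-⊆-diff {b} A B b∈ y y∈ with ∈-translate⁻ A y∈
  ... | a , a∈ , refl = subst (_∈ toList (A -ₛ B)) (+-comm a (- b)) (∈-diff⁺ A B a∈ b∈)

  translate-diff-⊆ : ∀ A c → c +ₛ A -ₛ [ c ] ⊆ A
  translate-diff-⊆ A c y y∈ with ∈-translate⁻ (A -ₛ [ c ]) y∈
  ... | z , z∈ , refl with ∈-diff⁻ A [ c ] z∈
  ... | a , _ , a∈ , here refl , refl = subst (_∈ toList A) (sym (x+[y-x]≡y c a)) a∈

  module SystemOfIdealsProperties {_▷_ : Pfe G → Carrier → Set}
                                  (isSystem : IsSystemOfIdeals G _▷_) where
    open IsSystemOfIdeals isSystem

    ▷-cutAll : ∀ Y {Γ Γ′ b} → (∀ {y} → y ∈ Y → Γ ▷ y) →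
      (∀ {x} → x ∈ toList Γ′ → x ∈ Y ⊎ x ∈ toList Γ) → Γ′ ▷ b → Γ ▷ b
    ▷-cutAll []      Y▷ Γ′⊆ Γ′▷b = ▷-mono (λ _ x∈ → [ (λ ()) , (λ x∈Γ → x∈Γ) ]′ (Γ′⊆ x∈)) Γ′▷b
    ▷-cutAll (y ∷ Y) {Γ} {Γ′} Y▷ Γ′⊆ Γ′▷b =
      ▷-cut (Y▷ (here refl)) (▷-cutAll Y (λ y∈ → ▷-mono (λ _ → there) (Y▷ (there y∈))) shift Γ′▷b)
      where
      shift : ∀ {x} → x ∈ toList Γ′ → x ∈ Y ⊎ x ∈ toList (Γ ,ₛ y)
      shift x∈ with Γ′⊆ x∈
      ... | inj₁ (here refl) = inj₂ (here refl)
      ... | inj₁ (there x∈Y) = inj₁ x∈Y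
      ... | inj₂ x∈Γ         = inj₂ (there x∈Γ)

    ▷-translate-point : ∀ {Γ x y} → [ 0# ] ▷ y → x ∈ toList Γ → Γ ▷ (x + y)
    ▷-translate-point {Γ} {x} 0▷y x∈ =
      ▷-mono (λ { _ (here refl) → subst (_∈ toList Γ) (sym (+-identityʳ x)) x∈ ; _ (there ()) }) (▷-trans x 0▷y)

    ▷-chasles : ∀ {Γ a b c} → [ 0# ] ▷ (b - c) → a - b ∈ toList Γ → Γ ▷ (a - c)
    ▷-chasles {Γ} {a} {b} {c} 0▷b-c a-b∈ =
      subst (Γ ▷_) ([x-y]+[y-z]≡x-z a b c) (▷-translate-point 0▷b-c a-b∈)

    ▷-diff : ∀ {A B b c} → A ▷ c → b ∈ toList B → (A -ₛ B) ▷ (c - b)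
    ▷-diff {A} {B} {b} {c} A▷c b∈ =
      subst ((A -ₛ B) ▷_) (+-comm (- b) c) (▷-mono (translate-⊆-diff A B b∈) (▷-trans (- b) A▷c))

    ▷-translate-diff : ∀ {A c} → (A -ₛ [ c ]) ▷ 0# → A ▷ c
    ▷-translate-diff {A} {c} d =
      subst (A ▷_) (+-identityʳ c) (▷-mono (translate-diff-⊆ A c) (▷-trans c d))

    ▷-cut-diffʳ : ∀ {A B c} → (∃[ b ] b ∈ toList B × [ 0# ] ▷ (b - c)) →
      (A -ₛ (B ,ₛ c)) ▷ 0# → (A -ₛ B) ▷ 0#
    ▷-cut-diffʳ {A} {B} {c} (b , b∈ , 0▷b-c) = ▷-cutAll (toList (A -ₛ [ c ])) A-c (diff-,ₛʳ A B c)
      where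
      A-c : ∀ {y} → y ∈ toList (A -ₛ [ c ]) → (A -ₛ B) ▷ y
      A-c y∈ with ∈-diff⁻ A [ c ] y∈
      ... | _ , _ , a∈ , here refl , refl = ▷-chasles 0▷b-c (∈-diff⁺ A B a∈ b∈)

    ▷-solve-diff-,ₛ : ∀ {A B c} → (∀ {b} → b ∈ toList B → [ 0# ] ▷ (c - b)) →
      (A -ₛ (B ,ₛ c)) ▷ 0# → A ▷ c
    ▷-solve-diff-,ₛ {A} {B} {c} 0▷c-B d =
      ▷-translate-diff (▷-cutAll (toList (A -ₛ B)) A-B (Sum.swap ∘ diff-,ₛʳ A B c) d)
      where
      A-B : ∀ {y} → y ∈ toList (A -ₛ B) → (A -ₛ [ c ]) ▷ y
      A-B y∈ with ∈-diff⁻ A B y∈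
      ... | _ , _ , a∈ , b∈ , refl = ▷-chasles (0▷c-B b∈) (∈-diff⁺ A [ c ] a∈ (here refl))

    ▷-cut-diffˡ : ∀ {A B c} → A ▷ c → ((A ,ₛ c) -ₛ B) ▷ 0# → (A -ₛ B) ▷ 0#
    ▷-cut-diffˡ {A} {B} {c} A▷c = ▷-cutAll (toList ([ c ] -ₛ B)) c-B (diff-,ₛˡ A B c)
      where
      c-B : ∀ {y} → y ∈ toList ([ c ] -ₛ B) → (A -ₛ B) ▷ y
      c-B y∈ with ∈-diff⁻ [ c ] B y∈
      ... | _ , _ , here refl , b∈ , refl = ▷-diff A▷c b∈

    ▷-cut-signs : ∀ {A B c} → All (λ b → [ 0# ] ▷ (b - c) ⊎ [ 0# ] ▷ (c - b)) (toList B) →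
      (A -ₛ (B ,ₛ c)) ▷ 0# → ((A ,ₛ c) -ₛ B) ▷ 0# → (A -ₛ B) ▷ 0#
    ▷-cut-signs {A} {B} {c} signs d₁ d₂ with All-⊎⇒Any⊎All signs
    ... | inj₁ some = ▷-cut-diffʳ {A} (find some) d₁
    ... | inj₂ all  = ▷-cut-diffˡ (▷-solve-diff-,ₛ {A} {B} (All.lookup all) d₁) d₂

  -- AllDNF t P (resp. AllCNF t P): P holds for every conjunctive (resp. disjunctive)
  -- clause of the normal form of t obtained by distributing ∧ over ∨ (resp. ∨ over ∧).
  AllDNF : Term G → (Pfe G → Set) → Set
  AllDNF (gen a) P = P [ a ]
  AllDNF (t ∧ s) P = AllDNF t (λ A → AllDNF s (λ A′ → P (A ⁺++⁺ A′)))
  AllDNF (t ∨ s) P = AllDNF t P × AllDNF s P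

  AllCNF : Term G → (Pfe G → Set) → Set
  AllCNF (gen a) P = P [ a ]
  AllCNF (t ∧ s) P = AllCNF t P × AllCNF s P
  AllCNF (t ∨ s) P = AllCNF t (λ C → AllCNF s (λ C′ → P (C ⁺++⁺ C′)))

  AllDNF-map : ∀ t {P Q : Pfe G → Set} → (∀ A → P A → Q A) → AllDNF t P → AllDNF t Q
  AllDNF-map (gen a) f p        = f _ p
  AllDNF-map (t ∧ s) f p        = AllDNF-map t (λ A → AllDNF-map s (λ A′ → f _)) p
  AllDNF-map (t ∨ s) f (p , q)  = AllDNF-map t f p , AllDNF-map s f q

  AllCNF-map : ∀ t {P Q : Pfe G → Set} → (∀ C → P C → Q C) → AllCNF t P → AllCNF t Q
  AllCNF-map (gen a) f p        = f _ p
  AllCNF-map (t ∧ s) f (p , q)  = AllCNF-map t f p , AllCNF-map s f q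
  AllCNF-map (t ∨ s) f p        = AllCNF-map t (λ C → AllCNF-map s (λ C′ → f _)) p

  AllDNF-tabulate : ∀ t {P : Pfe G → Set} → (∀ A → P A) → AllDNF t P
  AllDNF-tabulate (gen a) f = f _
  AllDNF-tabulate (t ∧ s) f = AllDNF-tabulate t (λ A → AllDNF-tabulate s (λ A′ → f _))
  AllDNF-tabulate (t ∨ s) f = AllDNF-tabulate t f , AllDNF-tabulate s f

  AllCNF-tabulate : ∀ t {P : Pfe G → Set} → (∀ C → P C) → AllCNF t P
  AllCNF-tabulate (gen a) f = f _
  AllCNF-tabulate (t ∧ s) f = AllCNF-tabulate t f , AllCNF-tabulate s f
  AllCNF-tabulate (t ∨ s) f = AllCNF-tabulate t (λ C → AllCNF-tabulate s (λ C′ → f _))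

  AllDNF-zip : ∀ t {P Q : Pfe G → Set} → AllDNF t P → AllDNF t Q → AllDNF t (λ A → P A × Q A)
  AllDNF-zip (gen a) p q              = p , q
  AllDNF-zip (t ∧ s) p q              = AllDNF-map t (λ A (p , q) → AllDNF-zip s p q) (AllDNF-zip t p q)
  AllDNF-zip (t ∨ s) (p , p′) (q , q′) = AllDNF-zip t p q , AllDNF-zip s p′ q′

  AllCNF-zip : ∀ t {P Q : Pfe G → Set} → AllCNF t P → AllCNF t Q → AllCNF t (λ C → P C × Q C)
  AllCNF-zip (gen a) p q              = p , q
  AllCNF-zip (t ∧ s) (p , p′) (q , q′) = AllCNF-zip t p q , AllCNF-zip s p′ q′
  AllCNF-zip (t ∨ s) p q              = AllCNF-map t (λ C (p , q) → AllCNF-zip s p q) (AllCNF-zip t p q)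

  AllDNF-AllCNF-swap : ∀ s u {Q : Pfe G → Pfe G → Set} →
    AllDNF s (λ A → AllCNF u (Q A)) → AllCNF u (λ C → AllDNF s (λ A → Q A C))
  AllDNF-AllCNF-swap (gen a)   u p       = p
  AllDNF-AllCNF-swap (s₁ ∧ s₂) u {Q} p   =
    AllDNF-AllCNF-swap s₁ u (AllDNF-map s₁ (λ A₁ → AllDNF-AllCNF-swap s₂ u {λ A₂ → Q (A₁ ⁺++⁺ A₂)}) p)
  AllDNF-AllCNF-swap (s₁ ∨ s₂) u (p , q) = AllCNF-zip u (AllDNF-AllCNF-swap s₁ u p) (AllDNF-AllCNF-swap s₂ u q)

  AllDNF-⋀ : ∀ a as {P : Pfe G → Set} → (∀ A′ → (a ∷ as) ⊆ A′ → P A′) → AllDNF (⋀ G (a ∷ as)) P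
  AllDNF-⋀ a []         f = f [ a ] ⊆-refl
  AllDNF-⋀ a (a′ ∷ as) {P} f = AllDNF-⋀ a′ as {λ A′ → P ([ a ] ⁺++⁺ A′)}
    (λ A′ A⊆ → f ([ a ] ⁺++⁺ A′) λ { x (here refl) → ⊆-⁺++⁺ˡ [ a ] A′ x (here refl)
                                        ; x (there x∈) → ⊆-⁺++⁺ʳ [ a ] A′ x (A⊆ x x∈) })

  AllCNF-⋁ : ∀ b bs {P : Pfe G → Set} → (∀ B′ → (b ∷ bs) ⊆ B′ → P B′) → AllCNF (⋁ G (b ∷ bs)) P
  AllCNF-⋁ b []         f = f [ b ] ⊆-refl
  AllCNF-⋁ b (b′ ∷ bs) {P} f = AllCNF-⋁ b′ bs {λ B′ → P ([ b ] ⁺++⁺ B′)}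
    (λ B′ B⊆ → f ([ b ] ⁺++⁺ B′) λ { x (here refl) → ⊆-⁺++⁺ˡ [ b ] B′ x (here refl)
                                        ; x (there x∈) → ⊆-⁺++⁺ʳ [ b ] B′ x (B⊆ x x∈) })

  module _ (R : Pfe G → Carrier → Set) where

    Ext-isSystemOfIdeals : ∀ ys → IsSystemOfIdeals G (Ext G R ys)
    Ext-isSystemOfIdeals ys = record
      { ▷-refl = e-refl ; ▷-mono = e-mono ; ▷-cut = e-cut ; ▷-ord = e-ord ; ▷-trans = e-trans }

    Ext-mono-generators : ∀ {ys ys′ A b} → (∀ {y} → y ∈ ys → y ∈ ys′) → Ext G R ys A b → Ext G R ys′ A b
    Ext-mono-generators ys⊆ (base A▷b)    = base A▷b
    Ext-mono-generators ys⊆ (extra y∈)    = extra (ys⊆ y∈)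
    Ext-mono-generators ys⊆ (e-refl a)    = e-refl a
    Ext-mono-generators ys⊆ (e-mono A⊆ d) = e-mono A⊆ (Ext-mono-generators ys⊆ d)
    Ext-mono-generators ys⊆ (e-cut d₁ d₂) = e-cut (Ext-mono-generators ys⊆ d₁) (Ext-mono-generators ys⊆ d₂)
    Ext-mono-generators ys⊆ (e-ord a≤b)   = e-ord a≤b
    Ext-mono-generators ys⊆ (e-trans x d) = e-trans x (Ext-mono-generators ys⊆ d)

    SignChoice-∈ : ∀ {xs ys x} → SignChoice G xs ys → x ∈ xs → x ∈ ys ⊎ - x ∈ ys
    SignChoice-∈ signs x∈ with Pointwise-∈ signs x∈
    ... | _ , y∈ , inj₁ refl = inj₁ y∈
    ... | _ , y∈ , inj₂ refl = inj₂ y∈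

    infix 4 _⊢_
    _⊢_ : Pfe G → Pfe G → Set
    _⊢_ = Reg G R

    ⊢-refl : ∀ a → [ a ] ⊢ [ a ]
    ⊢-refl a = [] , λ ys _ → subst (Ext G R ys [ a - a ]) (-‿inverseʳ a) (e-refl (a - a))

    ⊢-mono : ∀ {A A′ B B′} → A ⊆ A′ → B ⊆ B′ → A ⊢ B → A′ ⊢ B′
    ⊢-mono A⊆A′ B⊆B′ (xs , d) = xs , λ ys signs → e-mono (diff-mono A⊆A′ B⊆B′) (d ys signs)

    ⊢-monoˡ : ∀ {A A′} B → A ⊆ A′ → A ⊢ B → A′ ⊢ B
    ⊢-monoˡ {A} {A′} B A⊆A′ = ⊢-mono {A} {A′} {B} A⊆A′ ⊆-refl

    ⊢-monoʳ : ∀ A {B B′} → B ⊆ B′ → A ⊢ B → A ⊢ B′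
    ⊢-monoʳ A {B} {B′} = ⊢-mono {A} {A} {B} {B′} ⊆-refl

    ⊢-cut : ∀ {A B} c → A ⊢ [ c ] ⁺++⁺ B → [ c ] ⁺++⁺ A ⊢ B → A ⊢ B
    ⊢-cut {A@(_ ∷ _)} {B@(_ ∷ _)} c (xs₁ , d₁) (xs₂ , d₂) = xs₁ ++ xs₂ ++ toList (B -ₛ [ c ]) , d
      where
      d : ∀ ys → SignChoice G (xs₁ ++ xs₂ ++ toList (B -ₛ [ c ])) ys → Ext G R ys (A -ₛ B) 0#
      d ys signs with Pointwise-++⁻ˡ xs₁ signs
      ... | ys₁ , _ , signs₁ , signs′ , refl with Pointwise-++⁻ˡ xs₂ signs′
      ... | ys₂ , ys₃ , signs₂ , signs₃ , refl =
        ▷-cut-signs {A} {B} {c} (All.tabulate sign)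
          (Ext-mono-generators ∈-++⁺ˡ (d₁ ys₁ signs₁))
          (Ext-mono-generators (∈-++⁺ʳ ys₁ ∘ ∈-++⁺ˡ) (d₂ ys₂ signs₂))
        where
        open SystemOfIdealsProperties (Ext-isSystemOfIdeals (ys₁ ++ ys₂ ++ ys₃))
        generator : ∀ {y} → y ∈ ys₃ → Ext G R (ys₁ ++ ys₂ ++ ys₃) [ 0# ] y
        generator = extra ∘ ∈-++⁺ʳ ys₁ ∘ ∈-++⁺ʳ ys₂
        sign : ∀ {b} → b ∈ toList B →
          Ext G R (ys₁ ++ ys₂ ++ ys₃) [ 0# ] (b - c) ⊎ Ext G R (ys₁ ++ ys₂ ++ ys₃) [ 0# ] (c - b)
        sign {b} b∈ with SignChoice-∈ signs₃ (∈-diff⁺ B [ c ] b∈ (here refl))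
        ... | inj₁ b-c∈ = inj₁ (generator b-c∈)
        ... | inj₂ -[b-c]∈ = inj₂ (subst (Ext G R _ [ 0# ]) (-[x-y]≡y-x b c) (generator -[b-c]∈))

    infix 4 _⊢ᵀ_
    _⊢ᵀ_ : Term G → Term G → Set
    t ⊢ᵀ u = AllDNF t (λ A → AllCNF u (λ C → A ⊢ C))

    ∧-⊢ᵀˡ : ∀ t s u → t ⊢ᵀ u → t ∧ s ⊢ᵀ u
    ∧-⊢ᵀˡ t s u = AllDNF-map t λ A p →
      AllDNF-tabulate s λ A′ → AllCNF-map u (λ C → ⊢-monoˡ C (⊆-⁺++⁺ˡ A A′)) p

    ∧-⊢ᵀʳ : ∀ t s u → s ⊢ᵀ u → t ∧ s ⊢ᵀ u
    ∧-⊢ᵀʳ t s u p = AllDNF-tabulate t λ A →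
      AllDNF-map s (λ A′ → AllCNF-map u (λ C → ⊢-monoˡ C (⊆-⁺++⁺ʳ A A′))) p

    ⊢ᵀ-∨ˡ : ∀ t u v → t ⊢ᵀ u → t ⊢ᵀ u ∨ v
    ⊢ᵀ-∨ˡ t u v = AllDNF-map t λ A →
      AllCNF-map u λ C r → AllCNF-tabulate v λ C′ → ⊢-monoʳ A (⊆-⁺++⁺ˡ C C′) r

    ⊢ᵀ-∨ʳ : ∀ t u v → t ⊢ᵀ v → t ⊢ᵀ u ∨ v
    ⊢ᵀ-∨ʳ t u v = AllDNF-map t λ A p →
      AllCNF-tabulate u λ C → AllCNF-map v (λ C′ → ⊢-monoʳ A (⊆-⁺++⁺ʳ C C′)) p

    ⊢ᵀ-∧ : ∀ t u v → t ⊢ᵀ u → t ⊢ᵀ v → t ⊢ᵀ u ∧ v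
    ⊢ᵀ-∧ t u v = AllDNF-zip t {λ A → AllCNF u (A ⊢_)} {λ A → AllCNF v (A ⊢_)}

    ⊢ᵀ-refl : ∀ t → t ⊢ᵀ t
    ⊢ᵀ-refl (gen a) = ⊢-refl a
    ⊢ᵀ-refl (t ∧ s) = ⊢ᵀ-∧ (t ∧ s) t s (∧-⊢ᵀˡ t s t (⊢ᵀ-refl t)) (∧-⊢ᵀʳ t s s (⊢ᵀ-refl s))
    ⊢ᵀ-refl (t ∨ s) = ⊢ᵀ-∨ˡ t t s (⊢ᵀ-refl t) , ⊢ᵀ-∨ʳ s t s (⊢ᵀ-refl s)

    ⊢-cutᵀ : ∀ s {A B} → AllCNF s (λ C → A ⊢ C ⁺++⁺ B) → AllDNF s (λ D → D ⁺++⁺ A ⊢ B) → A ⊢ B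
    ⊢-cutᵀ (gen c) {A} {B} = ⊢-cut {A} {B} c
    ⊢-cutᵀ (s₁ ∧ s₂) {A} {B} (p₁ , p₂) q = ⊢-cutᵀ s₁ p₁ (AllDNF-map s₁ (λ D₁ q₁ →
      ⊢-cutᵀ s₂ (AllCNF-map s₂ (λ C → ⊢-monoˡ (C ⁺++⁺ B) (⊆-⁺++⁺ʳ D₁ A)) p₂)
                (AllDNF-map s₂ (λ D₂ → ⊢-monoˡ B (⁺++⁺-exchange-⊆ D₁ D₂ A)) q₁)) q)
    ⊢-cutᵀ (s₁ ∨ s₂) {A} {B} p (q₁ , q₂) = ⊢-cutᵀ s₁ (AllCNF-map s₁ (λ C₁ p₁ →
      ⊢-cutᵀ s₂ (AllCNF-map s₂ (λ C₂ → ⊢-monoʳ A (⁺++⁺-exchange-⊆ C₁ C₂ B)) p₁)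
                (AllDNF-map s₂ (λ D → ⊢-monoʳ (D ⁺++⁺ A) (⊆-⁺++⁺ʳ C₁ B)) q₂)) p) q₁

    ⊢ᵀ-trans : ∀ t s u → t ⊢ᵀ s → s ⊢ᵀ u → t ⊢ᵀ u
    ⊢ᵀ-trans t s u t⊢s s⊢u = AllDNF-map t (λ A A⊢s → AllCNF-map u (λ C s⊢C →
      ⊢-cutᵀ s (AllCNF-map s (λ D → ⊢-monoʳ A (⊆-⁺++⁺ˡ D C)) A⊢s)
               (AllDNF-map s (λ D → ⊢-monoˡ C (⊆-⁺++⁺ˡ D A)) s⊢C))
      (AllDNF-AllCNF-swap s u s⊢u)) t⊢s

    ⊢⇒⋀⊢ᵀ⋁ : ∀ A B → A ⊢ B → ⋀ G A ⊢ᵀ ⋁ G B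
    ⊢⇒⋀⊢ᵀ⋁ (a ∷ as) (b ∷ bs) A⊢B =
      AllDNF-⋀ a as λ A′ A⊆ → AllCNF-⋁ b bs λ B′ B⊆ → ⊢-mono A⊆ B⊆ A⊢B

    open Lorenzen G R using (_≤H_; h-refl; h-trans; ∧-lbˡ; ∧-lbʳ; ∧-glb; ∨-ubˡ; ∨-ubʳ; ∨-lub; distrib; entail)

    ≤H⇒⊢ᵀ : ∀ {x y} → x ≤H y → x ⊢ᵀ y
    ≤H⇒⊢ᵀ (h-refl {x})              = ⊢ᵀ-refl x
    ≤H⇒⊢ᵀ (h-trans {x} {y} {z} p q) = ⊢ᵀ-trans x y z (≤H⇒⊢ᵀ p) (≤H⇒⊢ᵀ q)
    ≤H⇒⊢ᵀ (∧-lbˡ {x} {y})           = ∧-⊢ᵀˡ x y x (⊢ᵀ-refl x)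
    ≤H⇒⊢ᵀ (∧-lbʳ {x} {y})           = ∧-⊢ᵀʳ x y y (⊢ᵀ-refl y)
    ≤H⇒⊢ᵀ (∧-glb {x} {y} {z} p q)   = ⊢ᵀ-∧ z x y (≤H⇒⊢ᵀ p) (≤H⇒⊢ᵀ q)
    ≤H⇒⊢ᵀ (∨-ubˡ {x} {y})           = ⊢ᵀ-∨ˡ x x y (⊢ᵀ-refl x)
    ≤H⇒⊢ᵀ (∨-ubʳ {x} {y})           = ⊢ᵀ-∨ʳ y x y (⊢ᵀ-refl y)
    ≤H⇒⊢ᵀ (∨-lub p q)               = ≤H⇒⊢ᵀ p , ≤H⇒⊢ᵀ q
    ≤H⇒⊢ᵀ (distrib {x} {y} {z})     = AllDNF-zip x
      (⊢ᵀ-∨ˡ (x ∧ y) (x ∧ y) (x ∧ z) (⊢ᵀ-refl (x ∧ y)))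
      (⊢ᵀ-∨ʳ (x ∧ z) (x ∧ y) (x ∧ z) (⊢ᵀ-refl (x ∧ z)))
    ≤H⇒⊢ᵀ (entail {A} {B} A⊢B)      = ⊢⇒⋀⊢ᵀ⋁ A B A⊢B

theorem4p9 : (G : OrderedGroup) → (_▷_ : Pfe G → OrderedGroup.Carrier G → Set) →
    IsSystemOfIdeals G _▷_ → Closed G _▷_ →
    ((a b : OrderedGroup.Carrier G) → Lorenzen._≈H_ G _▷_ (Lorenzen.ι G _▷_ a) (Lorenzen.ι G _▷_ b) → a ≡ b)
    × ((a b : OrderedGroup.Carrier G) → Lorenzen._≤H_ G _▷_ (Lorenzen.ι G _▷_ a) (Lorenzen.ι G _▷_ b) → OrderedGroup._≤_ G a b)
theorem4p9 G _▷_ _ closed = injective , reflects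
  where
  open OrderedGroup G using (Carrier; _≤_; ≤-antisym)
  open Lorenzen G _▷_ using (_≤H_; _≈H_; ι)

  reflects : (a b : Carrier) → ι a ≤H ι b → a ≤ b
  reflects a b ιa≤ιb = closed a b (≤H⇒⊢ᵀ G _▷_ ιa≤ιb)

  injective : (a b : Carrier) → ι a ≈H ι b → a ≡ b
  injective a b (ιa≤ιb , ιb≤ιa) = ≤-antisym (reflects a b ιa≤ιb) (reflects b a ιb≤ιa)
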